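{- Let $(P,\le)$ be a poset satisfying the Ascending Chain Condition and the Descending Chain Condition and let $\Theta$ be a congruence on $(P,\le)$. Every class $A\in P/\Theta$ has a least element, denoted $\bigwedge A$. For $A,B\in P/\Theta$ define $A\le B$ if $\bigwedge A\le\bigwedge B$. Then $A\mapsto\bigwedge A$ is an order isomorphism from $(P/\Theta,\le)$ to $(\{\bigwedge A\mid A\in P/\Theta\},\le)$ (with the order inherited from $P$), and hence $(P/\Theta,\le)$ is a poset that can be embedded into $(P,\le)$.
   Context: For a poset $(P,\le)$ and $x,y\in P$ let $L(x,y)=\{z\in P\mid z\le x,\ z\le y\}$ and $U(x,y)=\{z\in P\mid x\le z,\ y\le z\}$; for $A\subseteq P$, $\operatorname{Max}A$ and $\operatorname{Min}A$ denote the sets of maximal and minimal elements of $A$. A binary relation $R$ on $P$ is compatible with a map $Q\colon P^2\to 2^P$ if whenever $(a_1,b_1),(a_2,b_2)\in R$ there exist $a\in Q(a_1,a_2)$ and $b\in Q(b_1,b_2)$ with $(a,b)\in R$. A congruence on $(P,\le)$ is an equivalence relation on $P$ compatible with both $(x,y)\mapsto\operatorname{Max}L(x,y)$ and $(x,y)\mapsto\operatorname{Min}U(x,y)$. $P/\Theta$ is the set of classes of $\Theta$. An order isomorphism from a set with a binary relation $(P_1,\le)$ to a poset is a bijection $f$ with $x\le y\iff f(x)\le f(y)$. -}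

module Defs where

open import Level using (Level; _⊔_)
open import Data.Product using (Σ; ∃; _×_; _,_; proj₁)
open import Function using (flip)
open import Relation.Binary.Core using (Rel)
open import Relation.Binary.Structures using (IsPartialOrder; IsEquivalence)
open import Relation.Binary.Definitions using ()
open import Relation.Binary.PropositionalEquality using (_≡_; _≢_)
import Relation.Binary.PropositionalEquality
open import Induction.WellFounded using (WellFounded)

module _ {a ℓ : Level} {P : Set a} (_≤_ : Rel P ℓ) where

  _<_ : Rel P (a ⊔ ℓ)
  x < y = (x ≤ y) × (x ≢ y)

  DCC : Set (a ⊔ ℓ)
  DCC = WellFounded _<_

  ACC : Set (a ⊔ ℓ)
  ACC = WellFounded (flip _<_)

  InL : P → P → P → Set ℓ
  InL x y z = (z ≤ x) × (z ≤ y)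

  InU : P → P → P → Set ℓ
  InU x y z = (x ≤ z) × (y ≤ z)

  InMaxL : P → P → P → Set (a ⊔ ℓ)
  InMaxL x y z = InL x y z × (∀ w → InL x y w → z ≤ w → w ≡ z)

  InMinU : P → P → P → Set (a ⊔ ℓ)
  InMinU x y z = InU x y z × (∀ w → InU x y w → w ≤ z → w ≡ z)

  -- R is compatible with Q : P² → 2^P (Q given as a membership predicate Q x y z ⇔ z ∈ Q(x,y))
  Compatible : ∀ {r q} → Rel P r → (P → P → P → Set q) → Set (a ⊔ r ⊔ q)
  Compatible R Q = ∀ {a₁ b₁ a₂ b₂} → R a₁ b₁ → R a₂ b₂ →
                   Σ P λ u → Σ P λ v → Q a₁ a₂ u × Q b₁ b₂ v × R u v

  record IsCongruence {r} (Θ : Rel P r) : Set (a ⊔ ℓ ⊔ r) where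
    field
      isEquivalence : IsEquivalence Θ
      compatMaxL    : Compatible Θ InMaxL
      compatMinU    : Compatible Θ InMinU

  IsLeastOfClass : ∀ {r} → Rel P r → P → P → Set (a ⊔ ℓ ⊔ r)
  IsLeastOfClass Θ x m = Θ m x × (∀ y → Θ y x → m ≤ y)

  -- The image {⋀A | A ∈ P/Θ} of a map m : P → P (classes represented by representatives)
  Image : (P → P) → Set a
  Image m = Σ P λ z → ∃ λ x → z ≡ m x

  Image-intro : (m : P → P) → P → Image m
  Image-intro m x = m x , x , Relation.Binary.PropositionalEquality.refl

{-# OPTIONS --safe #-}
-- Applying compatibility with Max L to the pairs (x, x) and (x, y) for x Θ y yields a common
-- lower bound of x and y inside their class, so every class is downward directed.  By DCC
-- (and excluded middle) each class has a minimal element, which by directedness is least.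
-- Two elements are congruent exactly when their classes have the same least element, so Θ is
-- the kernel of ⋀; pulling ≤ back along ⋀ then gives a partial order modulo Θ, and ⋀ is an
-- order isomorphism onto its image.
module Submission where

open import Defs
open import Level using (Level)
open import Data.Product using (Σ; _×_; _,_; proj₁)
open import Relation.Binary.Core using (Rel)
open import Relation.Binary.Structures using (IsPartialOrder)
open import Relation.Binary.PropositionalEquality using (_≡_; refl)
open import Relation.Binary.Morphism.Structures using (IsOrderIsomorphism)
open import Axiom.ExcludedMiddle using (ExcludedMiddle)

open import Axiom.DoubleNegationElimination using (em⇒dne)
open import Data.Product using (proj₂)
open import Induction.WellFounded using (WellFounded; Acc; acc)
open import Relation.Binary.Definitions using (Reflexive; Antisymmetric)
open import Relation.Binary.Structures using (IsEquivalence)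
open import Relation.Nullary using (yes; no)
import Relation.Binary.PropositionalEquality as ≡

Minimal : ∀ {a ℓ q} {P : Set a} → Rel P ℓ → (P → Set q) → P → Set _
Minimal _≤_ Q m = Q m × (∀ y → Q y → y ≤ m → y ≡ m)

wellFounded⇒minimal : ∀ {ℓ} {P : Set ℓ} {_≤_ : Rel P ℓ} → ExcludedMiddle ℓ →
                      WellFounded (_<_ _≤_) → (Q : P → Set ℓ) →
                      ∀ {x} → Q x → Σ P (Minimal _≤_ Q)
wellFounded⇒minimal {P = P} {_≤_} em wf Q {x} = descend (wf x)
  where
  descend : ∀ {x} → Acc (_<_ _≤_) x → Q x → Σ P (Minimal _≤_ Q)
  descend {x} (acc below) qx with em {Σ P λ y → Q y × _<_ _≤_ y x}
  ... | yes (y , qy , y<x) = descend (below y<x) qy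
  ... | no ∄smaller = x , qx , λ y qy y≤x →
    em⇒dne em λ y≢x → ∄smaller (y , qy , y≤x , y≢x)

ClassesDownwardDirected : ∀ {a ℓ r} {P : Set a} → Rel P ℓ → Rel P r → Set _
ClassesDownwardDirected {P = P} _≤_ Θ =
  ∀ {x y} → Θ x y → Σ P λ v → v ≤ x × v ≤ y × Θ v x

module _ {a ℓ r} {P : Set a} {_≤_ : Rel P ℓ} {Θ : Rel P r} where

  maxL-diagonal : Reflexive _≤_ → ∀ {x u} → InMaxL _≤_ x x u → u ≡ x
  maxL-diagonal ≤-refl {x} ((u≤x , _) , maximal) = ≡.sym (maximal x (≤-refl , ≤-refl) u≤x)

  compatibleMaxL⇒classesDownwardDirected : Reflexive _≤_ → IsEquivalence Θ →
                                           Compatible _≤_ Θ (InMaxL _≤_) →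
                                           ClassesDownwardDirected _≤_ Θ
  compatibleMaxL⇒classesDownwardDirected ≤-refl Θ-equiv compat xΘy
    with compat (IsEquivalence.refl Θ-equiv) xΘy
  ... | u , v , u∈MaxL , ((v≤x , v≤y) , _) , uΘv
    rewrite maxL-diagonal ≤-refl u∈MaxL = v , v≤x , v≤y , IsEquivalence.sym Θ-equiv uΘv

  minimal⇒leastOfClass : IsEquivalence Θ → ClassesDownwardDirected _≤_ Θ →
                         ∀ {x m} → Minimal _≤_ (λ y → Θ y x) m → IsLeastOfClass _≤_ Θ x m
  minimal⇒leastOfClass Θ-equiv directed {x} {m} (mΘx , minimal) = mΘx , least
    where
    open IsEquivalence Θ-equiv
    least : ∀ y → Θ y x → m ≤ y
    least y yΘx with directed (trans mΘx (sym yΘx))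
    ... | v , v≤m , v≤y , vΘm with minimal v (trans vΘm mΘx) v≤m
    ...   | refl = v≤y

  leastOfClass-cong : Antisymmetric _≡_ _≤_ → IsEquivalence Θ → ∀ {x y m n} →
                      IsLeastOfClass _≤_ Θ x m → IsLeastOfClass _≤_ Θ y n → Θ x y → m ≡ n
  leastOfClass-cong antisym Θ-equiv (mΘx , m-least) (nΘy , n-least) xΘy =
    antisym (m-least _ (trans nΘy (sym xΘy))) (n-least _ (trans mΘx xΘy))
    where open IsEquivalence Θ-equiv

  leastOfClass-injective : IsEquivalence Θ → ∀ {x y m n} →
                           IsLeastOfClass _≤_ Θ x m → IsLeastOfClass _≤_ Θ y n → m ≡ n → Θ x y
  leastOfClass-injective Θ-equiv (mΘx , _) (nΘy , _) refl = trans (sym mΘx) nΘy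
    where open IsEquivalence Θ-equiv

leastOfClass : ∀ {ℓ} {P : Set ℓ} {_≤_ : Rel P ℓ} {Θ : Rel P ℓ} → ExcludedMiddle ℓ →
               Reflexive _≤_ → DCC _≤_ → IsCongruence _≤_ Θ →
               (x : P) → Σ P (IsLeastOfClass _≤_ Θ x)
leastOfClass {P = P} {_≤_} {Θ} em ≤-refl dcc congruence x =
  proj₁ minimalElement , minimal⇒leastOfClass isEquivalence directed (proj₂ minimalElement)
  where
  open IsCongruence congruence

  minimalElement : Σ P (Minimal _≤_ (λ y → Θ y x))
  minimalElement = wellFounded⇒minimal em dcc (λ y → Θ y x) (IsEquivalence.refl isEquivalence)

  directed : ClassesDownwardDirected _≤_ Θ
  directed = compatibleMaxL⇒classesDownwardDirected ≤-refl isEquivalence compatMaxL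

module Kernel {a ℓ r} {P : Set a} {_≤_ : Rel P ℓ} (≤-po : IsPartialOrder _≡_ _≤_)
              {Θ : Rel P r} (g : P → P)
              (g-cong : ∀ {x y} → Θ x y → g x ≡ g y)
              (g-injective : ∀ {x y} → g x ≡ g y → Θ x y) where

  open IsPartialOrder ≤-po using (antisym)
    renaming (reflexive to ≤-reflexive; trans to ≤-trans)

  image-isOrderIsomorphism : IsOrderIsomorphism Θ (λ u v → proj₁ u ≡ proj₁ v)
                               (λ x y → g x ≤ g y) (λ u v → proj₁ u ≤ proj₁ v)
                               (Image-intro _≤_ g)
  image-isOrderIsomorphism = record
    { isOrderMonomorphism = record
      { isOrderHomomorphism = record { cong = g-cong ; mono = λ gx≤gy → gx≤gy }
      ; injective = g-injective
      ; cancel = λ gx≤gy → gx≤gy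
      }
    ; surjective = λ { (_ , x , refl) → x , g-cong }
    }

  Θ-isEquivalence : IsEquivalence Θ
  Θ-isEquivalence = record
    { refl = g-injective refl
    ; sym = λ xΘy → g-injective (≡.sym (g-cong xΘy))
    ; trans = λ xΘy yΘz → g-injective (≡.trans (g-cong xΘy) (g-cong yΘz))
    }

  pullback-isPartialOrder : IsPartialOrder Θ (λ x y → g x ≤ g y)
  pullback-isPartialOrder = record
    { isPreorder = record
      { isEquivalence = Θ-isEquivalence
      ; reflexive = λ xΘy → ≤-reflexive (g-cong xΘy)
      ; trans = ≤-trans
      }
    ; antisym = λ gx≤gy gy≤gx → g-injective (antisym gx≤gy gy≤gx)
    }

corollary3p6 : {ℓ : Level} → ExcludedMiddle ℓ →
  (P : Set ℓ) (_≤_ : Rel P ℓ) → IsPartialOrder _≡_ _≤_ →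
  ACC _≤_ → DCC _≤_ →
  (Θ : Rel P ℓ) → IsCongruence _≤_ Θ →
  Σ ((x : P) → Σ P (IsLeastOfClass _≤_ Θ x)) λ least →
    let ⋀ = λ x → proj₁ (least x)
        _≤Θ_ = λ x y → ⋀ x ≤ ⋀ y
        _≈I_ = λ (u v : Image _≤_ ⋀) → proj₁ u ≡ proj₁ v
        _≤I_ = λ (u v : Image _≤_ ⋀) → proj₁ u ≤ proj₁ v
        f = λ x → Image-intro _≤_ ⋀ x
    in IsOrderIsomorphism Θ _≈I_ _≤Θ_ _≤I_ f
       × IsPartialOrder Θ _≤Θ_
corollary3p6 em P _≤_ ≤-po _ dcc Θ congruence =
  least , image-isOrderIsomorphism , pullback-isPartialOrder
  where
  open IsCongruence congruence using (isEquivalence)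
  open IsPartialOrder ≤-po using (antisym) renaming (refl to ≤-refl)

  least : (x : P) → Σ P (IsLeastOfClass _≤_ Θ x)
  least = leastOfClass em ≤-refl dcc congruence

  open Kernel ≤-po (λ x → proj₁ (least x))
    (leastOfClass-cong {_≤_ = _≤_} antisym isEquivalence (proj₂ (least _)) (proj₂ (least _)))
    (leastOfClass-injective {_≤_ = _≤_} isEquivalence (proj₂ (least _)) (proj₂ (least _)))
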